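{- Let $M$ be drawn from the with-replacement model $\underline{M}(3,1,n)$, let $(B_1,\dots,B_k)$ be a fixed sequence of subsets of $[n]$ with $|B_i|\in J_1$, and let $\mathcal{B}$ be the event that $(B_1,\dots,B_k)$ is a simple sequence of large row dependencies of $M$. Let $h_{\underline{x}}=|I_{\underline{x}}|$ for $\underline{x}\in\{0,1\}^k$. Given $\mathcal{B}$ and $i\in I_{\underline{x}}$, the row indices $\ell,\ell'$ of the two random non-zeros in column $i$ are distributed as follows. If $\underline{x}\ne\underline{0}$, choose $\underline{u},\underline{v}$ with $\underline{x}=\underline{u}+\underline{v}\pmod2$ with probability \[ p(\underline{u},\underline{v})=\frac{h_{\underline{u}}h_{\underline{v}}}{\sum_{\underline{y}+\underline{z}=\underline{x}}h_{\underline{y}}h_{\underline{z}}}, \] and then choose $\ell\in I_{\underline{u}}$, $\ell'\in I_{\underline{v}}$ uniformly at random. If $\underline{x}=\underline{0}$, choose $\underline{u}$ with probability $p(\underline{u},\underline{u})=h_{\underline{u}}^2/\sum_{\underline{y}\in\{0,1\}^k}h_{\underline{y}}^2$ and then choose $\ell,\ell'\in I_{\underline{u}}$ uniformly at random.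
   Context: With-replacement model $\underline{M}(3,1,n)$: random $n\times n$ matrix over $GF(2)$ with independent columns; column $i$ has a unit entry in row $i$ plus two unit entries in rows chosen independently and uniformly from $[n]$, entries added mod 2; all other entries zero. A dependency is a set of row indices whose rows sum to zero over $GF(2)$; it is large if its size lies in $J_1=\{\ell\in\mathbb{Z}: n/2-\sqrt{n\log n}\le\ell\le n/2+\sqrt{n\log n}\}$. A sequence $(B_1,\dots,B_k)$ of large dependencies is simple if for every nonempty $\{j_1<\dots<j_l\}\subseteq[k]$ the symmetric difference $B_{j_1}\oplus\cdots\oplus B_{j_l}$ has size in $J_1$. For $\underline{x}\in\{0,1\}^k$, $I_{\underline{x}}=\bigcap_{i=1}^kB_i^{(x_i)}$, where $B_i^{(1)}=B_i$, $B_i^{(0)}=[n]\setminus B_i$. -}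

module Defs where

open import Data.Bool using (Bool; true; false; _∧_; _xor_; not; if_then_else_)
open import Data.Bool.Properties using () renaming (_≟_ to _≟ᵇ_)
open import Data.Nat using (ℕ; zero; suc; _*_; _∸_; _^_; _≤_; _<_; ∣_-_∣)
open import Data.Nat.Combinatorics using (_P_)
open import Data.Nat using (_!)
open import Data.Nat.ListAction using (sum)
open import Data.Bool.ListAction using (all)
open import Data.Fin using (Fin; _≟_)
open import Data.Fin.Subset using (Subset; ∣_∣)
open import Data.Vec using (Vec; []; _∷_; lookup; map; zipWith; replicate; tabulate; toList)
open import Data.Vec.Properties using (≡-dec)
open import Data.List as L using (List)
open import Data.Product using (_×_; _,_; proj₁; proj₂)
open import Data.Integer using (+_)
open import Data.Rational as Q using (ℚ; 0ℚ)
open import Relation.Nullary.Decidable using (⌊_⌋)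
open import Relation.Binary.PropositionalEquality using (_≡_; _≢_)

-- The interval J₁ = { ℓ : n/2 - √(n log n) ≤ ℓ ≤ n/2 + √(n log n) }
-- (log = natural logarithm).  For n ≥ 1 this is  (2ℓ-n)² ≤ 4 n ln n,
-- i.e.  exp(a/b) ≤ n  with  a = (2ℓ-n)², b = 4n,  i.e. every partial sum
-- Σ_{j≤N} (a/b)^j / j!  of the exponential series is ≤ n.  Multiplying
-- by b^N N! this is the following inequality between naturals
-- (N P (N ∸ j) = N!/j! for j ≤ N).

expPartialScaled : ℕ → ℕ → ℕ → ℕ
expPartialScaled a b N =
  sum (L.map (λ j → a ^ j * b ^ (N ∸ j) * (N P (N ∸ j))) (L.upTo (suc N)))

inJ₁ : ℕ → ℕ → Set
inJ₁ n ℓ = ∀ N → expPartialScaled (∣ 2 * ℓ - n ∣ ^ 2) (4 * n) N ≤ n * (4 * n) ^ N * (N !)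

-- The probability space of M(3,1,n): column i has its diagonal unit
-- entry plus two unit entries in rows ω i = (ℓᵢ , ℓ'ᵢ), chosen
-- independently and uniformly; ω is uniform on (Fin n × Fin n)^n.

Outcome : ℕ → Set
Outcome n = Vec (Fin n × Fin n) n

allVecs : {A : Set} → List A → (m : ℕ) → List (Vec A m)
allVecs xs zero    = L.[ [] ]
allVecs xs (suc m) = L.concatMap (λ x → L.map (x ∷_) (allVecs xs m)) xs

allOutcomes : (n : ℕ) → List (Outcome n)
allOutcomes n = allVecs (L.cartesianProduct (L.allFin n) (L.allFin n)) n

count : {n : ℕ} → (Outcome n → Bool) → ℕ
count {n} E = sum (L.map (λ ω → if E ω then 1 else 0) (allOutcomes n))

entry : {n : ℕ} → Outcome n → Fin n → Fin n → Bool
entry ω r i = ⌊ r ≟ i ⌋ xor ⌊ r ≟ proj₁ (lookup ω i) ⌋ xor ⌊ r ≟ proj₂ (lookup ω i) ⌋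

isDependency : {n : ℕ} → Outcome n → Subset n → Bool
isDependency {n} ω D =
  all (λ i → not (L.foldr _xor_ false
                      (L.map (λ r → lookup D r ∧ entry ω r i) (L.allFin n))))
        (L.allFin n)

allDependencies : {n k : ℕ} → Outcome n → Vec (Subset n) k → Bool
allDependencies ω Bs = all (isDependency ω) (toList Bs)

symDiffSel : {n k : ℕ} → Vec (Subset n) k → Vec Bool k → Subset n
symDiffSel Bs J =
  tabulate (λ r → L.foldr _xor_ false (toList (zipWith (λ B s → s ∧ lookup B r) Bs J)))

Simple : {n k : ℕ} → Vec (Subset n) k → Set
Simple {n} {k} Bs = ∀ (J : Vec Bool k) → J ≢ replicate k false → inJ₁ n ∣ symDiffSel Bs J ∣

cls : {n k : ℕ} → Vec (Subset n) k → Fin n → Vec Bool k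
cls Bs r = map (λ B → lookup B r) Bs

inI : {n k : ℕ} → Vec (Subset n) k → Vec Bool k → Fin n → Bool
inI Bs x r = ⌊ ≡-dec _≟ᵇ_ (cls Bs r) x ⌋

ind : Bool → ℕ
ind b = if b then 1 else 0

h : {n k : ℕ} → Vec (Subset n) k → Vec Bool k → ℕ
h {n} Bs x = sum (L.map (λ r → ind (inI Bs x r)) (L.allFin n))

allBits : (k : ℕ) → List (Vec Bool k)
allBits k = allVecs (true L.∷ false L.∷ L.[]) k

xorV : {k : ℕ} → Vec Bool k → Vec Bool k → Vec Bool k
xorV = zipWith _xor_

isZeroV : {k : ℕ} → Vec Bool k → Bool
isZeroV {k} x = ⌊ ≡-dec _≟ᵇ_ x (replicate k false) ⌋

-- Rationals: m / d, with the convention m / 0 = 0 (only ever used where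
-- the corresponding term has probability 0 anyway).

frac : ℕ → ℕ → ℚ
frac m zero    = 0ℚ
frac m (suc d) = (+ m) Q./ suc d

sumQ : {A : Set} → (A → ℚ) → List A → ℚ
sumQ f xs = L.foldr (λ a s → f a Q.+ s) 0ℚ xs

condProb : {n k : ℕ} → Vec (Subset n) k → Fin n → Fin n → Fin n → ℚ
condProb Bs i a b =
  frac (count (λ ω → allDependencies ω Bs
                     ∧ ⌊ proj₁ (lookup ω i) ≟ a ⌋ ∧ ⌊ proj₂ (lookup ω i) ≟ b ⌋))
       (count (λ ω → allDependencies ω Bs))

procDist : {n k : ℕ} → Vec (Subset n) k → Vec Bool k → Fin n → Fin n → ℚ
procDist {n} {k} Bs x a b with isZeroV x
... | false =
  let pairs = L.cartesianProduct (allBits k) (allBits k)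
      okPair : Vec Bool k × Vec Bool k → Bool
      okPair = λ p → ⌊ ≡-dec _≟ᵇ_ (xorV (proj₁ p) (proj₂ p)) x ⌋
      S = sum (L.map (λ p → ind (okPair p) * (h Bs (proj₁ p) * h Bs (proj₂ p))) pairs)
  in sumQ (λ p → frac (ind (okPair p)) 1
                   Q.* frac (h Bs (proj₁ p) * h Bs (proj₂ p)) S
                   Q.* frac (ind (inI Bs (proj₁ p) a)) (h Bs (proj₁ p))
                   Q.* frac (ind (inI Bs (proj₂ p) b)) (h Bs (proj₂ p)))
          pairs
... | true =
  let S = sum (L.map (λ y → h Bs y * h Bs y) (allBits k))
  in sumQ (λ u → frac (h Bs u * h Bs u) S
                   Q.* frac (ind (inI Bs u a)) (h Bs u)
                   Q.* frac (ind (inI Bs u b)) (h Bs u))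
          (allBits k)

-- Column j of M has an even number of unit entries in the rows of Bₜ iff Bₜ contains an even
-- number of j, ℓⱼ, ℓ′ⱼ; for all t at once, iff the cells of ℓⱼ and ℓ′ⱼ add up (mod 2) to the cell
-- of j. So 𝓑 is a conjunction of conditions on single columns: the columns stay independent given
-- 𝓑, and (ℓᵢ, ℓ′ᵢ) is uniform on the pairs of rows whose cells add up to the cell x of i. The
-- two-step procedure has the same law, since h_u h_v counts those pairs with ℓ ∈ I_u, ℓ′ ∈ I_v
-- (for x = 0 they are the pairs inside one cell, counted by h_u²).
module Submission where

open import Algebra.Bundles using (CommutativeMonoid; CommutativeRing)
open import Algebra.Core using (Op₂)
open import Algebra.Structures using (IsCommutativeMonoid; IsCommutativeSemiring)
open import Data.Bool using (Bool; true; false; _∧_; _xor_; not; if_then_else_)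
open import Data.Bool.Properties
  using ( xor-∧-commutativeRing; ∧-isCommutativeMonoid; ∧-distribˡ-xor; ∧-identityʳ; ∧-zeroʳ
        ; xor-comm; xor-identityʳ )
  renaming (_≟_ to _≟ᵇ_)
open import Data.Empty using (⊥-elim)
open import Data.Fin using (Fin; zero; suc; _≟_)
open import Data.Fin.Properties using (suc-injective)
open import Data.Fin.Subset using (Subset; ∣_∣)
import Data.Integer as ℤ
open import Data.Integer.Properties using (pos-*)
open import Data.List using (List; []; _∷_; _++_; foldr; map; concatMap; cartesianProduct; allFin)
open import Data.List.Properties using (map-cong; map-∘; map-tabulate)
open import Data.Nat using (ℕ; zero; suc; _+_; _*_; _≤_; _<_; z<s)
import Data.Nat.Properties as ℕₚ
open import Data.Nat.Tactic.RingSolver using (solve-∀)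
open import Data.Product using (_×_; _,_; proj₁; proj₂)
open import Data.Rational as ℚ using (ℚ; 0ℚ)
import Data.Rational.Properties as ℚₚ
open import Data.Rational.Unnormalised as ℚᵘ using (ℚᵘ; mkℚᵘ; *≡*)
import Data.Rational.Unnormalised.Properties as ℚᵘₚ
open import Data.Vec using (Vec; []; _∷_; lookup; replicate; toList)
open import Data.Vec.Properties using (∷-injectiveˡ; ∷-injectiveʳ; ≡-dec)
open import Function using (_∘_)
open import Level using (0ℓ)
open import Relation.Binary.Definitions using (DecidableEquality)
open import Relation.Binary.PropositionalEquality
open import Relation.Nullary using (Dec; yes; no; ¬_)
open import Relation.Nullary.Decidable using (⌊_⌋; isYes; isYes≗does; dec-true; dec-false)

open import Defs

module BigOperator {A : Set} {_∙_ : Op₂ A} {ε : A}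
                   (isCommutativeMonoid : IsCommutativeMonoid _≡_ _∙_ ε) where

  open IsCommutativeMonoid isCommutativeMonoid using (identityˡ; identityʳ; assoc; comm)

  private
    commutativeMonoid : CommutativeMonoid 0ℓ 0ℓ
    commutativeMonoid = record { isCommutativeMonoid = isCommutativeMonoid }

  open import Algebra.Properties.CommutativeSemigroup
    (CommutativeMonoid.commutativeSemigroup commutativeMonoid) using (interchange)

  open ≡-Reasoning

  private variable
    X Y : Set

  ∑ : (X → A) → List X → A
  ∑ f xs = foldr _∙_ ε (map f xs)

  ∑-cong : ∀ {f g : X → A} → f ≗ g → ∀ xs → ∑ f xs ≡ ∑ g xs
  ∑-cong f≗g xs = cong (foldr _∙_ ε) (map-cong f≗g xs)

  ∑-ε : ∀ (f : X → A) → (∀ x → f x ≡ ε) → ∀ xs → ∑ f xs ≡ ε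
  ∑-ε f f≡ε []       = refl
  ∑-ε f f≡ε (x ∷ xs) = trans (cong₂ _∙_ (f≡ε x) (∑-ε f f≡ε xs)) (identityˡ ε)

  ∑-++ : ∀ (f : X → A) xs ys → ∑ f (xs ++ ys) ≡ ∑ f xs ∙ ∑ f ys
  ∑-++ f []       ys = sym (identityˡ _)
  ∑-++ f (x ∷ xs) ys = trans (cong (f x ∙_) (∑-++ f xs ys)) (sym (assoc _ _ _))

  ∑-map : ∀ (f : Y → A) (g : X → Y) xs → ∑ f (map g xs) ≡ ∑ (f ∘ g) xs
  ∑-map f g xs = cong (foldr _∙_ ε) (sym (map-∘ xs))

  ∑-concatMap : ∀ (f : Y → A) (g : X → List Y) xs →
                ∑ f (concatMap g xs) ≡ ∑ (λ x → ∑ f (g x)) xs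
  ∑-concatMap f g []       = refl
  ∑-concatMap f g (x ∷ xs) =
    trans (∑-++ f (g x) (concatMap g xs)) (cong (∑ f (g x) ∙_) (∑-concatMap f g xs))

  ∑-cartesianProduct : ∀ (f : X × Y → A) xs ys →
    ∑ f (cartesianProduct xs ys) ≡ ∑ (λ x → ∑ (λ y → f (x , y)) ys) xs
  ∑-cartesianProduct f []       ys = refl
  ∑-cartesianProduct f (x ∷ xs) ys =
    trans (∑-++ f (map (x ,_) ys) (cartesianProduct xs ys))
          (cong₂ _∙_ (∑-map f (x ,_) ys) (∑-cartesianProduct f xs ys))

  ∑-distrib : ∀ (f g : X → A) xs → ∑ (λ x → f x ∙ g x) xs ≡ ∑ f xs ∙ ∑ g xs
  ∑-distrib f g []       = sym (identityˡ ε)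
  ∑-distrib f g (x ∷ xs) =
    trans (cong ((f x ∙ g x) ∙_) (∑-distrib f g xs)) (interchange _ _ _ _)

  ∑-comm : ∀ (f : X → Y → A) xs ys →
           ∑ (λ x → ∑ (f x) ys) xs ≡ ∑ (λ y → ∑ (λ x → f x y) xs) ys
  ∑-comm f []       ys = sym (∑-ε _ (λ _ → refl) ys)
  ∑-comm f (x ∷ xs) ys =
    trans (cong (∑ (f x) ys ∙_) (∑-comm f xs ys))
          (sym (∑-distrib (f x) (λ y → ∑ (λ x′ → f x′ y) xs) ys))

  ∑-fused : ∀ (f : X → A) xs → foldr (λ x s → f x ∙ s) ε xs ≡ ∑ f xs
  ∑-fused f []       = refl
  ∑-fused f (x ∷ xs) = cong (f x ∙_) (∑-fused f xs)

  ∑-allFin-suc : ∀ {n} (f : Fin (suc n) → A) →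
                 ∑ f (allFin (suc n)) ≡ f zero ∙ ∑ (f ∘ suc) (allFin n)
  ∑-allFin-suc f = cong (λ ys → f zero ∙ foldr _∙_ ε ys)
    (trans (map-tabulate suc f) (sym (map-tabulate (λ i → i) (f ∘ suc))))

  ∑-agree-off : ∀ {n} (f g : Fin n → A) i → (∀ j → j ≢ i → f j ≡ g j) →
                ∑ f (allFin n) ∙ g i ≡ ∑ g (allFin n) ∙ f i
  ∑-agree-off {suc n} f g zero f≡g = begin
    ∑ f (allFin (suc n)) ∙ g zero            ≡⟨ cong (_∙ g zero) (∑-allFin-suc f) ⟩
    (f zero ∙ ∑ (f ∘ suc) (allFin n)) ∙ g zero
      ≡⟨ cong (λ r → (f zero ∙ r) ∙ g zero) (∑-cong (λ j → f≡g (suc j) λ ()) (allFin n)) ⟩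
    (f zero ∙ R) ∙ g zero                    ≡⟨ assoc (f zero) R (g zero) ⟩
    f zero ∙ (R ∙ g zero)                    ≡⟨ cong (f zero ∙_) (comm R (g zero)) ⟩
    f zero ∙ (g zero ∙ R)                    ≡⟨ comm (f zero) (g zero ∙ R) ⟩
    (g zero ∙ R) ∙ f zero                    ≡⟨ cong (_∙ f zero) (∑-allFin-suc g) ⟨
    ∑ g (allFin (suc n)) ∙ f zero            ∎
    where
    R : A
    R = ∑ (g ∘ suc) (allFin n)
  ∑-agree-off {suc n} f g (suc i) f≡g = begin
    ∑ f (allFin (suc n)) ∙ g (suc i)              ≡⟨ cong (_∙ g (suc i)) (∑-allFin-suc f) ⟩
    (f zero ∙ ∑ (f ∘ suc) (allFin n)) ∙ g (suc i)  ≡⟨ assoc (f zero) _ _ ⟩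
    f zero ∙ (∑ (f ∘ suc) (allFin n) ∙ g (suc i))
      ≡⟨ cong₂ _∙_ (f≡g zero λ ())
                   (∑-agree-off (f ∘ suc) (g ∘ suc) i (λ j j≢i → f≡g (suc j) (j≢i ∘ suc-injective))) ⟩
    g zero ∙ (∑ (g ∘ suc) (allFin n) ∙ f (suc i))  ≡⟨ assoc (g zero) _ _ ⟨
    (g zero ∙ ∑ (g ∘ suc) (allFin n)) ∙ f (suc i)  ≡⟨ cong (_∙ f (suc i)) (∑-allFin-suc g) ⟨
    ∑ g (allFin (suc n)) ∙ f (suc i)              ∎

  -- Over a nontrivial monoid this says that xs lists every element of X exactly once.
  ExactlyOnce : List X → Set
  ExactlyOnce {X} xs = ∀ (c : X) (f : X → A) → (∀ x → x ≢ c → f x ≡ ε) → ∑ f xs ≡ f c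

  allFin-exactlyOnce : ∀ n → ExactlyOnce (allFin n)
  allFin-exactlyOnce (suc n) zero    f f≡ε =
    trans (∑-allFin-suc f)
      (trans (cong (f zero ∙_) (∑-ε (f ∘ suc) (λ j → f≡ε (suc j) λ ()) (allFin n))) (identityʳ _))
  allFin-exactlyOnce (suc n) (suc c) f f≡ε =
    trans (∑-allFin-suc f)
      (trans (cong₂ _∙_ (f≡ε zero λ ())
                        (allFin-exactlyOnce n c (f ∘ suc) (λ j j≢c → f≡ε (suc j) (j≢c ∘ suc-injective))))
             (identityˡ _))

  cartesianProduct-exactlyOnce : ∀ {xs : List X} {ys : List Y} →
    ExactlyOnce xs → ExactlyOnce ys → ExactlyOnce (cartesianProduct xs ys)
  cartesianProduct-exactlyOnce {xs = xs} {ys} once-xs once-ys (c , d) f f≡ε =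
    trans (∑-cartesianProduct f xs ys)
      (trans (once-xs c _ (λ x x≢c → ∑-ε _ (λ y → f≡ε (x , y) (x≢c ∘ cong proj₁)) ys))
             (once-ys d _ (λ y y≢d → f≡ε (c , y) (y≢d ∘ cong proj₂))))

  allVecs-exactlyOnce : ∀ {xs : List X} → ExactlyOnce xs → ∀ m → ExactlyOnce (allVecs xs m)
  allVecs-exactlyOnce once zero    []      f f≡ε = identityʳ (f [])
  allVecs-exactlyOnce {xs = xs} once (suc m) (c ∷ cs) f f≡ε =
    trans (∑-concatMap f _ xs)
      (trans (once c _ (λ x x≢c → trans (∑-map f (x ∷_) (allVecs xs m))
                                     (∑-ε _ (λ v → f≡ε (x ∷ v) (x≢c ∘ ∷-injectiveˡ)) (allVecs xs m))))
        (trans (∑-map f (c ∷_) (allVecs xs m))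
               (allVecs-exactlyOnce once m cs (f ∘ (c ∷_)) (λ v v≢cs → f≡ε (c ∷ v) (v≢cs ∘ ∷-injectiveʳ)))))

  bits-exactlyOnce : ExactlyOnce (true ∷ false ∷ [])
  bits-exactlyOnce true  f f≡ε =
    trans (cong (f true ∙_) (trans (cong (_∙ ε) (f≡ε false λ ())) (identityˡ ε))) (identityʳ _)
  bits-exactlyOnce false f f≡ε = trans (cong₂ _∙_ (f≡ε true λ ()) (identityʳ _)) (identityˡ _)

  allBits-exactlyOnce : ∀ k → ExactlyOnce (allBits k)
  allBits-exactlyOnce = allVecs-exactlyOnce {xs = true ∷ false ∷ []} bits-exactlyOnce

module SemiringBigOperator {A : Set} {_+_ _*_ : Op₂ A} {0# 1# : A}
    (isCommutativeSemiring : IsCommutativeSemiring _≡_ _+_ _*_ 0# 1#) where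

  open IsCommutativeSemiring isCommutativeSemiring
    using (+-isCommutativeMonoid; *-isCommutativeMonoid; +-identityʳ; distribˡ; zeroˡ; zeroʳ; *-comm)
  open BigOperator +-isCommutativeMonoid public
  module Product = BigOperator *-isCommutativeMonoid
  open Product public using () renaming (∑ to ∏)
  open ≡-Reasoning

  private variable
    X Y : Set

  ∑-*ˡ : ∀ c (f : X → A) xs → c * ∑ f xs ≡ ∑ (λ x → c * f x) xs
  ∑-*ˡ c f []       = zeroʳ c
  ∑-*ˡ c f (x ∷ xs) = trans (distribˡ c (f x) (∑ f xs)) (cong ((c * f x) +_) (∑-*ˡ c f xs))

  ∑-*ʳ : ∀ c (f : X → A) xs → ∑ f xs * c ≡ ∑ (λ x → f x * c) xs
  ∑-*ʳ c f xs =
    trans (*-comm (∑ f xs) c) (trans (∑-*ˡ c f xs) (∑-cong (λ x → *-comm c (f x)) xs))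

  ∏-zero : ∀ {n} (f : Fin n → A) i → f i ≡ 0# → ∏ f (allFin n) ≡ 0#
  ∏-zero {suc n} f zero    f₀≡0 =
    trans (Product.∑-allFin-suc f) (trans (cong (_* ∏ (f ∘ suc) (allFin n)) f₀≡0) (zeroˡ _))
  ∏-zero {suc n} f (suc i) fᵢ≡0 =
    trans (Product.∑-allFin-suc f) (trans (cong (f zero *_) (∏-zero (f ∘ suc) i fᵢ≡0)) (zeroʳ (f zero)))

  ∑-allVecs-∏ : ∀ {m} (G : Fin m → X → A) xs →
    ∑ (λ v → ∏ (λ j → G j (lookup v j)) (allFin m)) (allVecs xs m) ≡ ∏ (λ j → ∑ (G j) xs) (allFin m)
  ∑-allVecs-∏ {m = zero}  G xs = +-identityʳ 1#
  ∑-allVecs-∏ {m = suc m} G xs = begin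
    ∑ (λ v → ∏ (λ j → G j (lookup v j)) (allFin (suc m))) (allVecs xs (suc m))
      ≡⟨ ∑-concatMap _ _ xs ⟩
    ∑ (λ x → ∑ (λ v → ∏ (λ j → G j (lookup v j)) (allFin (suc m))) (map (x ∷_) (allVecs xs m))) xs
      ≡⟨ ∑-cong (λ x → ∑-map _ (x ∷_) (allVecs xs m)) xs ⟩
    ∑ (λ x → ∑ (λ v → ∏ (λ j → G j (lookup (x ∷ v) j)) (allFin (suc m))) (allVecs xs m)) xs
      ≡⟨ ∑-cong (λ x → ∑-cong (λ v → Product.∑-allFin-suc (λ j → G j (lookup (x ∷ v) j)))
                               (allVecs xs m)) xs ⟩
    ∑ (λ x → ∑ (λ v → G zero x * ∏ (λ j → G (suc j) (lookup v j)) (allFin m)) (allVecs xs m)) xs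
      ≡⟨ ∑-cong (λ x → ∑-*ˡ (G zero x) _ (allVecs xs m)) xs ⟨
    ∑ (λ x → G zero x * ∑ (λ v → ∏ (λ j → G (suc j) (lookup v j)) (allFin m)) (allVecs xs m)) xs
      ≡⟨ ∑-cong (λ x → cong (G zero x *_) (∑-allVecs-∏ (G ∘ suc) xs)) xs ⟩
    ∑ (λ x → G zero x * ∏ (λ j → ∑ (G (suc j)) xs) (allFin m)) xs
      ≡⟨ ∑-*ʳ _ (G zero) xs ⟨
    ∑ (G zero) xs * ∏ (λ j → ∑ (G (suc j)) xs) (allFin m)
      ≡⟨ Product.∑-allFin-suc (λ j → ∑ (G j) xs) ⟨
    ∏ (λ j → ∑ (G j) xs) (allFin (suc m)) ∎

isYes-true : ∀ {P : Set} (P? : Dec P) → P → isYes P? ≡ true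
isYes-true P? p = trans (isYes≗does P?) (dec-true P? p)

isYes-false : ∀ {P : Set} (P? : Dec P) → ¬ P → isYes P? ≡ false
isYes-false P? ¬p = trans (isYes≗does P?) (dec-false P? ¬p)

≟ᵇ-xor : ∀ x y → ⌊ x ≟ᵇ y ⌋ ≡ not (x xor y)
≟ᵇ-xor false false = refl
≟ᵇ-xor false true  = refl
≟ᵇ-xor true  false = refl
≟ᵇ-xor true  true  = refl

infix 4 _==_

_==_ : ∀ {k} → Vec Bool k → Vec Bool k → Bool
u == v = ⌊ ≡-dec _≟ᵇ_ u v ⌋

==-refl : ∀ {k} (u : Vec Bool k) → (u == u) ≡ true
==-refl u = isYes-true (≡-dec _≟ᵇ_ u u) refl

==-≢ : ∀ {k} {u v : Vec Bool k} → u ≢ v → (u == v) ≡ false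
==-≢ {u = u} {v} = isYes-false (≡-dec _≟ᵇ_ u v)

==-sound : ∀ {k} (u v : Vec Bool k) → (u == v) ≡ true → u ≡ v
==-sound u v with ≡-dec _≟ᵇ_ u v
... | yes u≡v = λ _ → u≡v
... | no  _   = λ ()

==-∷ : ∀ {k} a b (u v : Vec Bool k) → (a ∷ u == b ∷ v) ≡ ⌊ a ≟ᵇ b ⌋ ∧ (u == v)
==-∷ a b u v = trans (isYes≗does (≡-dec _≟ᵇ_ (a ∷ u) (b ∷ v)))
  (sym (cong₂ _∧_ (isYes≗does (a ≟ᵇ b)) (isYes≗does (≡-dec _≟ᵇ_ u v))))

xorV-==-zero : ∀ {k} (u v : Vec Bool k) → (xorV u v == replicate k false) ≡ (v == u)
xorV-==-zero []      []      = refl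
xorV-==-zero (a ∷ u) (b ∷ v) = begin
  (xorV (a ∷ u) (b ∷ v) == replicate _ false)            ≡⟨ ==-∷ (a xor b) false (xorV u v) _ ⟩
  ⌊ a xor b ≟ᵇ false ⌋ ∧ (xorV u v == replicate _ false)  ≡⟨ cong₂ _∧_ bit (xorV-==-zero u v) ⟩
  ⌊ b ≟ᵇ a ⌋ ∧ (v == u)                                   ≡⟨ ==-∷ b a v u ⟨
  (b ∷ v == a ∷ u)                                        ∎
  where
  open ≡-Reasoning
  bit : ⌊ a xor b ≟ᵇ false ⌋ ≡ ⌊ b ≟ᵇ a ⌋
  bit = trans (≟ᵇ-xor (a xor b) false)
        (trans (cong not (trans (xor-identityʳ (a xor b)) (xor-comm a b))) (sym (≟ᵇ-xor b a)))

xor-isCommutativeMonoid : IsCommutativeMonoid _≡_ _xor_ false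
xor-isCommutativeMonoid = CommutativeRing.+-isCommutativeMonoid xor-∧-commutativeRing

module Conjunction = BigOperator ∧-isCommutativeMonoid
module Parity      = BigOperator xor-isCommutativeMonoid

fits : ∀ {n k} → Vec (Subset n) k → Vec Bool k → Fin n × Fin n → Bool
fits Bs x (l , l′) = xorV (cls Bs l) (cls Bs l′) == x

xor-select : ∀ {n} (D : Subset n) c → Parity.∑ (λ r → lookup D r ∧ ⌊ r ≟ c ⌋) (allFin n) ≡ lookup D c
xor-select {n} D c =
  trans (Parity.allFin-exactlyOnce n c _
           (λ r r≢c → trans (cong (lookup D r ∧_) (isYes-false (r ≟ c) r≢c)) (∧-zeroʳ _)))
        (trans (cong (lookup D c ∧_) (isYes-true (c ≟ c) refl)) (∧-identityʳ _))

column-parity : ∀ {n} (D : Subset n) (i l l′ : Fin n) →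
  Parity.∑ (λ r → lookup D r ∧ (⌊ r ≟ i ⌋ xor ⌊ r ≟ l ⌋ xor ⌊ r ≟ l′ ⌋)) (allFin n)
  ≡ lookup D i xor lookup D l xor lookup D l′
column-parity {n} D i l l′ = begin
  Parity.∑ (λ r → lookup D r ∧ (⌊ r ≟ i ⌋ xor ⌊ r ≟ l ⌋ xor ⌊ r ≟ l′ ⌋)) (allFin n)
    ≡⟨ Parity.∑-cong (λ r → trans (∧-distribˡ-xor (lookup D r) ⌊ r ≟ i ⌋ _)
                              (cong (sel i r xor_) (∧-distribˡ-xor (lookup D r) ⌊ r ≟ l ⌋ _))) (allFin n) ⟩
  Parity.∑ (λ r → sel i r xor sel l r xor sel l′ r) (allFin n)
    ≡⟨ Parity.∑-distrib (sel i) (λ r → sel l r xor sel l′ r) (allFin n) ⟩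
  Parity.∑ (sel i) (allFin n) xor Parity.∑ (λ r → sel l r xor sel l′ r) (allFin n)
    ≡⟨ cong (Parity.∑ (sel i) (allFin n) xor_) (Parity.∑-distrib (sel l) (sel l′) (allFin n)) ⟩
  Parity.∑ (sel i) (allFin n) xor Parity.∑ (sel l) (allFin n) xor Parity.∑ (sel l′) (allFin n)
    ≡⟨ cong₂ _xor_ (xor-select D i) (cong₂ _xor_ (xor-select D l) (xor-select D l′)) ⟩
  lookup D i xor lookup D l xor lookup D l′ ∎
  where
  open ≡-Reasoning
  sel : Fin n → Fin n → Bool
  sel c r = lookup D r ∧ ⌊ r ≟ c ⌋

parities-fit : ∀ {n k} (Bs : Vec (Subset n) k) (j l l′ : Fin n) →
  Conjunction.∑ (λ D → not (lookup D j xor lookup D l xor lookup D l′)) (toList Bs)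
  ≡ fits Bs (cls Bs j) (l , l′)
parities-fit []       j l l′ = refl
parities-fit (D ∷ Bs) j l l′ =
  trans (cong₂ _∧_ bit (parities-fit Bs j l l′)) (sym (==-∷ _ _ (xorV (cls Bs l) (cls Bs l′)) (cls Bs j)))
  where
  bit : not (lookup D j xor lookup D l xor lookup D l′) ≡ ⌊ lookup D l xor lookup D l′ ≟ᵇ lookup D j ⌋
  bit = trans (cong not (xor-comm (lookup D j) _)) (sym (≟ᵇ-xor _ _))

allDependencies-columns : ∀ {n k} (ω : Outcome n) (Bs : Vec (Subset n) k) →
  allDependencies ω Bs ≡ Conjunction.∑ (λ j → fits Bs (cls Bs j) (lookup ω j)) (allFin n)
allDependencies-columns {n} ω Bs = begin
  Conjunction.∑ (isDependency ω) (toList Bs)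
    ≡⟨ Conjunction.∑-cong (λ D → Conjunction.∑-cong (λ j → cong not
         (column-parity D j (proj₁ (lookup ω j)) (proj₂ (lookup ω j)))) (allFin n)) (toList Bs) ⟩
  Conjunction.∑ (λ D → Conjunction.∑ (parity D) (allFin n)) (toList Bs)
    ≡⟨ Conjunction.∑-comm parity (toList Bs) (allFin n) ⟩
  Conjunction.∑ (λ j → Conjunction.∑ (λ D → parity D j) (toList Bs)) (allFin n)
    ≡⟨ Conjunction.∑-cong (λ j → parities-fit Bs j (proj₁ (lookup ω j)) (proj₂ (lookup ω j))) (allFin n) ⟩
  Conjunction.∑ (λ j → fits Bs (cls Bs j) (lookup ω j)) (allFin n) ∎
  where
  open ≡-Reasoning
  parity : Subset n → Fin n → Bool
  parity D j = not (lookup D j xor lookup D (proj₁ (lookup ω j)) xor lookup D (proj₂ (lookup ω j)))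

open SemiringBigOperator ℕₚ.+-*-isCommutativeSemiring

pairs : ∀ n → List (Fin n × Fin n)
pairs n = cartesianProduct (allFin n) (allFin n)

pairs-exactlyOnce : ∀ n → ExactlyOnce (pairs n)
pairs-exactlyOnce n =
  cartesianProduct-exactlyOnce {xs = allFin n} {ys = allFin n} (allFin-exactlyOnce n) (allFin-exactlyOnce n)

ind-∧ : ∀ a b → ind (a ∧ b) ≡ ind a * ind b
ind-∧ true  b = sym (ℕₚ.*-identityˡ (ind b))
ind-∧ false b = refl

ind-⋀ : ∀ {X : Set} (f : X → Bool) xs → ind (Conjunction.∑ f xs) ≡ ∏ (ind ∘ f) xs
ind-⋀ f []       = refl
ind-⋀ f (x ∷ xs) = trans (ind-∧ (f x) _) (cong (ind (f x) *_) (ind-⋀ f xs))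

count-cong : ∀ {n} {E F : Outcome n → Bool} → (∀ ω → E ω ≡ F ω) → count E ≡ count F
count-cong {n} E≡F = ∑-cong (cong ind ∘ E≡F) (allOutcomes n)

count-columnwise : ∀ {n} (E : Fin n → Fin n × Fin n → Bool) →
  count (λ ω → Conjunction.∑ (λ j → E j (lookup ω j)) (allFin n))
  ≡ ∏ (λ j → ∑ (ind ∘ E j) (pairs n)) (allFin n)
count-columnwise {n} E =
  trans (∑-cong (λ ω → ind-⋀ (λ j → E j (lookup ω j)) (allFin n)) (allOutcomes n))
        (∑-allVecs-∏ (λ j → ind ∘ E j) (pairs n))

∑-fibres : ∀ {X Y : Set} {xs : List X} → ExactlyOnce xs →
  (_≟ₓ_ : DecidableEquality X) (c : Y → X) (F : X → ℕ) (ys : List Y) →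
  ∑ (λ x → ∑ (λ y → ind ⌊ c y ≟ₓ x ⌋) ys * F x) xs ≡ ∑ (F ∘ c) ys
∑-fibres {xs = xs} once _≟ₓ_ c F ys = begin
  ∑ (λ x → ∑ (λ y → ind ⌊ c y ≟ₓ x ⌋) ys * F x) xs  ≡⟨ ∑-cong (λ x → ∑-*ʳ (F x) _ ys) xs ⟩
  ∑ (λ x → ∑ (λ y → ind ⌊ c y ≟ₓ x ⌋ * F x) ys) xs  ≡⟨ ∑-comm (λ x y → ind ⌊ c y ≟ₓ x ⌋ * F x) xs ys ⟩
  ∑ (λ y → ∑ (λ x → ind ⌊ c y ≟ₓ x ⌋ * F x) xs) ys  ≡⟨ ∑-cong fibre ys ⟩
  ∑ (F ∘ c) ys                                      ∎
  where
  open ≡-Reasoning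
  fibre : ∀ y → ∑ (λ x → ind ⌊ c y ≟ₓ x ⌋ * F x) xs ≡ F (c y)
  fibre y =
    trans (once (c y) _ (λ x x≢cy → cong (λ t → ind t * F x) (isYes-false (c y ≟ₓ x) (x≢cy ∘ sym))))
          (trans (cong (λ t → ind t * F (c y)) (isYes-true (c y ≟ₓ c y) refl)) (ℕₚ.*-identityˡ (F (c y))))

fitting : ∀ {n k} → Vec (Subset n) k → Vec Bool k → ℕ
fitting {n} Bs x = ∑ (ind ∘ fits Bs x) (pairs n)

∑-cells : ∀ {n k} (Bs : Vec (Subset n) k) (F : Vec Bool k → ℕ) →
  ∑ (λ u → h Bs u * F u) (allBits k) ≡ ∑ (F ∘ cls Bs) (allFin n)
∑-cells {n} {k} Bs F = ∑-fibres {xs = allBits k} (allBits-exactlyOnce k) (≡-dec _≟ᵇ_) (cls Bs) F (allFin n)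

∑-cellPairs : ∀ {n k} (Bs : Vec (Subset n) k) (W : Vec Bool k → Vec Bool k → ℕ) →
  ∑ (λ p → W (proj₁ p) (proj₂ p) * (h Bs (proj₁ p) * h Bs (proj₂ p)))
    (cartesianProduct (allBits k) (allBits k))
  ≡ ∑ (λ q → W (cls Bs (proj₁ q)) (cls Bs (proj₂ q))) (pairs n)
∑-cellPairs {n} {k} Bs W = begin
  ∑ (λ p → W (proj₁ p) (proj₂ p) * (h Bs (proj₁ p) * h Bs (proj₂ p)))
    (cartesianProduct (allBits k) (allBits k))
    ≡⟨ ∑-cartesianProduct _ (allBits k) (allBits k) ⟩
  ∑ (λ u → ∑ (λ v → W u v * (h Bs u * h Bs v)) (allBits k)) (allBits k)
    ≡⟨ ∑-cong (λ u → trans (∑-cong (λ v → rearrange (W u v) (h Bs u) (h Bs v)) (allBits k))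
                           (sym (∑-*ˡ (h Bs u) _ (allBits k)))) (allBits k) ⟩
  ∑ (λ u → h Bs u * ∑ (λ v → h Bs v * W u v) (allBits k)) (allBits k)
    ≡⟨ ∑-cong (λ u → cong (h Bs u *_) (∑-cells Bs (W u))) (allBits k) ⟩
  ∑ (λ u → h Bs u * ∑ (λ l′ → W u (cls Bs l′)) (allFin n)) (allBits k)
    ≡⟨ ∑-cells Bs (λ u → ∑ (λ l′ → W u (cls Bs l′)) (allFin n)) ⟩
  ∑ (λ l → ∑ (λ l′ → W (cls Bs l) (cls Bs l′)) (allFin n)) (allFin n)
    ≡⟨ ∑-cartesianProduct _ (allFin n) (allFin n) ⟨
  ∑ (λ q → W (cls Bs (proj₁ q)) (cls Bs (proj₂ q))) (pairs n) ∎
  where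
  open ≡-Reasoning
  rearrange : ∀ w a b → w * (a * b) ≡ a * (b * w)
  rearrange w a b = trans (ℕₚ.*-comm w (a * b)) (ℕₚ.*-assoc a b w)

∑-cells-squared : ∀ {n k} (Bs : Vec (Subset n) k) →
  ∑ (λ u → h Bs u * h Bs u) (allBits k) ≡ fitting Bs (replicate k false)
∑-cells-squared {n} {k} Bs = begin
  ∑ (λ u → h Bs u * h Bs u) (allBits k)
    ≡⟨ ∑-cells Bs (h Bs) ⟩
  ∑ (λ l → ∑ (λ l′ → ind (cls Bs l′ == cls Bs l)) (allFin n)) (allFin n)
    ≡⟨ ∑-cartesianProduct _ (allFin n) (allFin n) ⟨
  ∑ (λ q → ind (cls Bs (proj₂ q) == cls Bs (proj₁ q))) (pairs n)
    ≡⟨ ∑-cong (λ q → cong ind (xorV-==-zero (cls Bs (proj₁ q)) (cls Bs (proj₂ q)))) (pairs n) ⟨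
  fitting Bs (replicate k false) ∎
  where open ≡-Reasoning

∑-allFin-≥ : ∀ {n} (f : Fin n → ℕ) i → f i ≤ ∑ f (allFin n)
∑-allFin-≥ {suc n} f zero    = ℕₚ.≤-trans (ℕₚ.m≤m+n (f zero) _) (ℕₚ.≤-reflexive (sym (∑-allFin-suc f)))
∑-allFin-≥ {suc n} f (suc i) = ℕₚ.≤-trans (∑-allFin-≥ (f ∘ suc) i)
  (ℕₚ.≤-trans (ℕₚ.m≤n+m _ (f zero)) (ℕₚ.≤-reflexive (sym (∑-allFin-suc f))))

frac-zero : ∀ d → frac 0 d ≡ 0ℚ
frac-zero zero    = refl
frac-zero (suc d) = ℚₚ.0/n≡0 (suc d)

frac-cross : ∀ {m n m′ n′} → 0 < n → 0 < n′ → m * n′ ≡ m′ * n → frac m n ≡ frac m′ n′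
frac-cross {m} {suc n} {m′} {suc n′} _ _ eq = ℚₚ.fromℚᵘ-cong {mkℚᵘ (ℤ.+ m) n} {mkℚᵘ (ℤ.+ m′) n′}
  (*≡* (trans (sym (pos-* m (suc n′))) (trans (cong ℤ.+_ eq) (pos-* m′ (suc n)))))

frac-* : ∀ m n m′ n′ → frac m (suc n) ℚ.* frac m′ (suc n′) ≡ frac (m * m′) (suc n * suc n′)
frac-* m n m′ n′ = ℚₚ.toℚᵘ-injective (begin
  ℚ.toℚᵘ (ℚ.fromℚᵘ p ℚ.* ℚ.fromℚᵘ q)            ≈⟨ ℚₚ.toℚᵘ-homo-* (ℚ.fromℚᵘ p) (ℚ.fromℚᵘ q) ⟩
  ℚ.toℚᵘ (ℚ.fromℚᵘ p) ℚᵘ.* ℚ.toℚᵘ (ℚ.fromℚᵘ q)  ≈⟨ ℚᵘₚ.*-cong (ℚₚ.toℚᵘ-fromℚᵘ p) (ℚₚ.toℚᵘ-fromℚᵘ q) ⟩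
  p ℚᵘ.* q                                      ≡⟨ cong (λ z → mkℚᵘ z _) (sym (pos-* m m′)) ⟩
  mkℚᵘ (ℤ.+ (m * m′)) _                         ≈⟨ ℚₚ.toℚᵘ-fromℚᵘ (mkℚᵘ (ℤ.+ (m * m′)) _) ⟨
  ℚ.toℚᵘ (frac (m * m′) (suc n * suc n′))       ∎)
  where
  open ℚᵘₚ.≃-Reasoning
  p q : ℚᵘ
  p = mkℚᵘ (ℤ.+ m) n
  q = mkℚᵘ (ℤ.+ m′) n′

-- Also for S = 0, where both sides are the junk value frac _ 0 = 0.
frac-cancel : ∀ m m′ S {a b} → 0 < a → 0 < b →
              frac (a * b) S ℚ.* frac m a ℚ.* frac m′ b ≡ frac (m * m′) S
frac-cancel m m′ zero {a} {b} _ _ =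
  trans (cong (ℚ._* frac m′ b) (ℚₚ.*-zeroˡ (frac m a))) (ℚₚ.*-zeroˡ (frac m′ b))
frac-cancel m m′ (suc s) {suc A} {suc B} _ _ =
  trans (cong (ℚ._* frac m′ (suc B)) (frac-* (suc A * suc B) s m A))
    (trans (frac-* (suc A * suc B * m) (A + s * suc A) m′ B)
           (frac-cross {suc A * suc B * m * m′} {suc s * suc A * suc B} {m * m′} {suc s} z<s z<s
                       (cross m m′ s A B)))
  where
  cross : ∀ m m′ s A B → suc A * suc B * m * m′ * suc s ≡ m * m′ * (suc s * suc A * suc B)
  cross = solve-∀

frac-∏ : ∀ {n} (f g : Fin n → ℕ) i → (∀ j → j ≢ i → f j ≡ g j) → 0 < ∏ g (allFin n) →
         frac (∏ f (allFin n)) (∏ g (allFin n)) ≡ frac (f i) (g i)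
frac-∏ f g i f≡g ∏g>0 =
  frac-cross ∏g>0 gᵢ>0 (trans (Product.∑-agree-off f g i f≡g) (ℕₚ.*-comm _ (f i)))
  where
  gᵢ>0 : 0 < g i
  gᵢ>0 = ℕₚ.n≢0⇒n>0 (ℕₚ.n>0⇒n≢0 ∏g>0 ∘ ∏-zero g i)

frac-1-* : ∀ m m′ d → frac m 1 ℚ.* frac m′ d ≡ frac (m * m′) d
frac-1-* m m′ zero    = ℚₚ.*-zeroʳ (frac m 1)
frac-1-* m m′ (suc d) =
  trans (frac-* m 0 m′ d) (frac-cross {m * m′} {1 * suc d} {m * m′} {suc d} z<s z<s
    (cong (m * m′ *_) (sym (ℕₚ.*-identityˡ (suc d)))))

frac-1-cancel : ∀ m S {a b} → 0 < a → 0 < b →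
                frac m 1 ℚ.* frac (a * b) S ℚ.* frac 1 a ℚ.* frac 1 b ≡ frac m S
frac-1-cancel m S {a} {b} a>0 b>0 = begin
  frac m 1 ℚ.* frac (a * b) S ℚ.* frac 1 a ℚ.* frac 1 b
    ≡⟨ cong (ℚ._* frac 1 b) (ℚₚ.*-assoc (frac m 1) (frac (a * b) S) (frac 1 a)) ⟩
  frac m 1 ℚ.* (frac (a * b) S ℚ.* frac 1 a) ℚ.* frac 1 b
    ≡⟨ ℚₚ.*-assoc (frac m 1) (frac (a * b) S ℚ.* frac 1 a) (frac 1 b) ⟩
  frac m 1 ℚ.* (frac (a * b) S ℚ.* frac 1 a ℚ.* frac 1 b)
    ≡⟨ cong (frac m 1 ℚ.*_) (frac-cancel 1 1 S a>0 b>0) ⟩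
  frac m 1 ℚ.* frac 1 S                           ≡⟨ frac-1-* m 1 S ⟩
  frac (m * 1) S                                  ≡⟨ cong (λ t → frac t S) (ℕₚ.*-identityʳ m) ⟩
  frac m S                                        ∎
  where open ≡-Reasoning

module RationalSum = BigOperator ℚₚ.+-0-isCommutativeMonoid

uniform : ∀ {n k} → Vec (Subset n) k → Vec Bool k → Fin n → ℚ
uniform Bs u r = frac (ind (inI Bs u r)) (h Bs u)

uniform-other : ∀ {n k} (Bs : Vec (Subset n) k) {u r} → u ≢ cls Bs r → uniform Bs u r ≡ 0ℚ
uniform-other Bs {u} {r} u≢ =
  trans (cong (λ t → frac (ind t) (h Bs u)) (==-≢ (u≢ ∘ sym))) (frac-zero (h Bs u))

uniform-own : ∀ {n k} (Bs : Vec (Subset n) k) r → uniform Bs (cls Bs r) r ≡ frac 1 (h Bs (cls Bs r))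
uniform-own Bs r = cong (λ t → frac (ind t) (h Bs (cls Bs r))) (==-refl (cls Bs r))

h-cls>0 : ∀ {n k} (Bs : Vec (Subset n) k) r → 0 < h Bs (cls Bs r)
h-cls>0 {n} Bs r = ℕₚ.≤-trans (ℕₚ.≤-reflexive (cong ind (sym (==-refl (cls Bs r)))))
                                  (∑-allFin-≥ (λ r′ → ind (inI Bs (cls Bs r) r′)) r)

*-zero-middle : ∀ p q r → q ≡ 0ℚ → p ℚ.* q ℚ.* r ≡ 0ℚ
*-zero-middle p q r refl = trans (cong (ℚ._* r) (ℚₚ.*-zeroʳ p)) (ℚₚ.*-zeroˡ r)

procDist-fits : ∀ {n k} (Bs : Vec (Subset n) k) x a b →
  procDist Bs x a b ≡ frac (ind (fits Bs x (a , b))) (fitting Bs x)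
procDist-fits {n} {k} Bs x a b with isZeroV x in x≟0
... | false = begin
  sumQ term cellPairs                         ≡⟨ RationalSum.∑-fused term cellPairs ⟩
  RationalSum.∑ term cellPairs                ≡⟨ cellPairs-exactlyOnce (cls Bs a , cls Bs b) term vanish ⟩
  term (cls Bs a , cls Bs b)
    ≡⟨ cong₂ (λ s t → choose (cls Bs a) (cls Bs b) ℚ.* s ℚ.* t) (uniform-own Bs a) (uniform-own Bs b) ⟩
  choose (cls Bs a) (cls Bs b) ℚ.* frac 1 (h Bs (cls Bs a)) ℚ.* frac 1 (h Bs (cls Bs b))
    ≡⟨ frac-1-cancel (ind (fits Bs x (a , b))) S (h-cls>0 Bs a) (h-cls>0 Bs b) ⟩
  frac (ind (fits Bs x (a , b))) S
    ≡⟨ cong (frac (ind (fits Bs x (a , b)))) (∑-cellPairs Bs (λ u v → ind (xorV u v == x))) ⟩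
  frac (ind (fits Bs x (a , b))) (fitting Bs x) ∎
  where
  open ≡-Reasoning
  cellPairs : List (Vec Bool k × Vec Bool k)
  cellPairs = cartesianProduct (allBits k) (allBits k)
  cellPairs-exactlyOnce : RationalSum.ExactlyOnce cellPairs
  cellPairs-exactlyOnce = RationalSum.cartesianProduct-exactlyOnce {xs = allBits k} {ys = allBits k}
    (RationalSum.allBits-exactlyOnce k) (RationalSum.allBits-exactlyOnce k)
  S : ℕ
  S = ∑ (λ p → ind (xorV (proj₁ p) (proj₂ p) == x) * (h Bs (proj₁ p) * h Bs (proj₂ p))) cellPairs
  choose : Vec Bool k → Vec Bool k → ℚ
  choose u v = frac (ind (xorV u v == x)) 1 ℚ.* frac (h Bs u * h Bs v) S
  term : Vec Bool k × Vec Bool k → ℚ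
  term (u , v) = choose u v ℚ.* uniform Bs u a ℚ.* uniform Bs v b
  vanish : ∀ p → p ≢ (cls Bs a , cls Bs b) → term p ≡ 0ℚ
  vanish (u , v) p≢ with ≡-dec _≟ᵇ_ u (cls Bs a)
  ... | no u≢    = *-zero-middle (choose u v) (uniform Bs u a) (uniform Bs v b) (uniform-other Bs u≢)
  ... | yes refl = trans (cong (choose u v ℚ.* uniform Bs u a ℚ.*_) (uniform-other Bs (p≢ ∘ cong (u ,_))))
                         (ℚₚ.*-zeroʳ (choose u v ℚ.* uniform Bs u a))
... | true  = begin
  sumQ term (allBits k)                 ≡⟨ RationalSum.∑-fused term (allBits k) ⟩
  RationalSum.∑ term (allBits k)        ≡⟨ RationalSum.allBits-exactlyOnce k (cls Bs a) term vanish ⟩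
  term (cls Bs a)                       ≡⟨ cong (λ s → frac (hₐ * hₐ) S ℚ.* s ℚ.* uniform Bs (cls Bs a) b)
                                                (uniform-own Bs a) ⟩
  frac (hₐ * hₐ) S ℚ.* frac 1 hₐ ℚ.* frac (ind same) hₐ
                                        ≡⟨ frac-cancel 1 (ind same) S (h-cls>0 Bs a) (h-cls>0 Bs a) ⟩
  frac (1 * ind same) S
    ≡⟨ cong₂ frac (trans (ℕₚ.*-identityˡ (ind same)) (cong ind (sym fits≡same)))
                  (trans (∑-cells-squared Bs) (cong (fitting Bs) (sym x≡0))) ⟩
  frac (ind (fits Bs x (a , b))) (fitting Bs x) ∎
  where
  open ≡-Reasoning
  x≡0 : x ≡ replicate k false
  x≡0 = ==-sound x (replicate k false) x≟0
  hₐ : ℕ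
  hₐ = h Bs (cls Bs a)
  same : Bool
  same = cls Bs b == cls Bs a
  fits≡same : fits Bs x (a , b) ≡ same
  fits≡same = trans (cong (xorV (cls Bs a) (cls Bs b) ==_) x≡0) (xorV-==-zero (cls Bs a) (cls Bs b))
  S : ℕ
  S = ∑ (λ y → h Bs y * h Bs y) (allBits k)
  term : Vec Bool k → ℚ
  term u = frac (h Bs u * h Bs u) S ℚ.* uniform Bs u a ℚ.* uniform Bs u b
  vanish : ∀ u → u ≢ cls Bs a → term u ≡ 0ℚ
  vanish u u≢ =
    *-zero-middle (frac (h Bs u * h Bs u) S) (uniform Bs u a) (uniform Bs u b) (uniform-other Bs u≢)

hits : ∀ {n} → Fin n → Fin n → Fin n × Fin n → Bool
hits a b (l , l′) = ⌊ l ≟ a ⌋ ∧ ⌊ l′ ≟ b ⌋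

hits-≢ : ∀ {n} {a b : Fin n} p → p ≢ (a , b) → hits a b p ≡ false
hits-≢ {a = a} {b} (l , l′) p≢ with l ≟ a | l′ ≟ b
... | yes refl | yes refl = ⊥-elim (p≢ refl)
... | yes _    | no _     = refl
... | no _     | _        = refl

hits-refl : ∀ {n} (a b : Fin n) → hits a b (a , b) ≡ true
hits-refl a b = cong₂ _∧_ (isYes-true (a ≟ a) refl) (isYes-true (b ≟ b) refl)

pinned : ∀ {n k} → Vec (Subset n) k → (i a b j : Fin n) → Fin n × Fin n → Bool
pinned Bs i a b j p = fits Bs (cls Bs j) p ∧ (if ⌊ j ≟ i ⌋ then hits a b p else true)

count-dependencies : ∀ {n k} (Bs : Vec (Subset n) k) →
  count (λ ω → allDependencies ω Bs) ≡ ∏ (λ j → fitting Bs (cls Bs j)) (allFin n)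
count-dependencies Bs =
  trans (count-cong (λ ω → allDependencies-columns ω Bs)) (count-columnwise (λ j → fits Bs (cls Bs j)))

count-pinned : ∀ {n k} (Bs : Vec (Subset n) k) (i a b : Fin n) →
  count (λ ω → allDependencies ω Bs ∧ hits a b (lookup ω i))
  ≡ ∏ (λ j → ∑ (ind ∘ pinned Bs i a b j) (pairs n)) (allFin n)
count-pinned {n} Bs i a b = trans (count-cong columns) (count-columnwise (pinned Bs i a b))
  where
  only-i : ∀ (ω : Outcome n) →
    Conjunction.∑ (λ j → if ⌊ j ≟ i ⌋ then hits a b (lookup ω j) else true) (allFin n)
    ≡ hits a b (lookup ω i)
  only-i ω = trans
    (Conjunction.allFin-exactlyOnce n i _
      (λ j j≢i → cong (λ t → if t then hits a b (lookup ω j) else true) (isYes-false (j ≟ i) j≢i)))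
    (cong (λ t → if t then hits a b (lookup ω i) else true) (isYes-true (i ≟ i) refl))
  columns : ∀ ω → (allDependencies ω Bs ∧ hits a b (lookup ω i))
                  ≡ Conjunction.∑ (λ j → pinned Bs i a b j (lookup ω j)) (allFin n)
  columns ω = sym (trans (Conjunction.∑-distrib _ _ (allFin n))
                         (cong₂ _∧_ (sym (allDependencies-columns ω Bs)) (only-i ω)))

pinned-off : ∀ {n k} (Bs : Vec (Subset n) k) (i a b j : Fin n) → j ≢ i →
  ∑ (ind ∘ pinned Bs i a b j) (pairs n) ≡ fitting Bs (cls Bs j)
pinned-off {n} Bs i a b j j≢i = ∑-cong (λ p → cong ind
  (trans (cong (λ t → fits Bs (cls Bs j) p ∧ (if t then hits a b p else true)) (isYes-false (j ≟ i) j≢i))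
         (∧-identityʳ _))) (pairs n)

pinned-on : ∀ {n k} (Bs : Vec (Subset n) k) (i a b : Fin n) →
  ∑ (ind ∘ pinned Bs i a b i) (pairs n) ≡ ind (fits Bs (cls Bs i) (a , b))
pinned-on {n} Bs i a b = begin
  ∑ (ind ∘ pinned Bs i a b i) (pairs n)
    ≡⟨ ∑-cong (λ p → cong (λ t → ind (fits Bs (cls Bs i) p ∧ (if t then hits a b p else true)))
                          (isYes-true (i ≟ i) refl)) (pairs n) ⟩
  ∑ (λ p → ind (fits Bs (cls Bs i) p ∧ hits a b p)) (pairs n)
    ≡⟨ pairs-exactlyOnce n (a , b) _ (λ p p≢ →
         trans (cong (λ t → ind (fits Bs (cls Bs i) p ∧ t)) (hits-≢ p p≢)) (cong ind (∧-zeroʳ _))) ⟩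
  ind (fits Bs (cls Bs i) (a , b) ∧ hits a b (a , b))
    ≡⟨ cong (λ t → ind (fits Bs (cls Bs i) (a , b) ∧ t)) (hits-refl a b) ⟩
  ind (fits Bs (cls Bs i) (a , b) ∧ true)
    ≡⟨ cong ind (∧-identityʳ _) ⟩
  ind (fits Bs (cls Bs i) (a , b)) ∎
  where open ≡-Reasoning

lemma10 : (n k : ℕ) (Bs : Vec (Subset n) k)
          → (∀ j → inJ₁ n ∣ lookup Bs j ∣)
          → Simple Bs
          → 0 < count (λ ω → allDependencies ω Bs)
          → (i a b : Fin n)
          → condProb Bs i a b ≡ procDist Bs (cls Bs i) a b
lemma10 n k Bs _ _ 𝓑>0 i a b = begin
  condProb Bs i a b
    ≡⟨ cong₂ frac (count-pinned Bs i a b) (count-dependencies Bs) ⟩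
  frac (∏ (λ j → ∑ (ind ∘ pinned Bs i a b j) (pairs n)) (allFin n))
       (∏ (λ j → fitting Bs (cls Bs j)) (allFin n))
    ≡⟨ frac-∏ _ _ i (pinned-off Bs i a b) (subst (0 <_) (count-dependencies Bs) 𝓑>0) ⟩
  frac (∑ (ind ∘ pinned Bs i a b i) (pairs n)) (fitting Bs (cls Bs i))
    ≡⟨ cong (λ m → frac m (fitting Bs (cls Bs i))) (pinned-on Bs i a b) ⟩
  frac (ind (fits Bs (cls Bs i) (a , b))) (fitting Bs (cls Bs i))
    ≡⟨ procDist-fits Bs (cls Bs i) a b ⟨
  procDist Bs (cls Bs i) a b ∎
  where open ≡-Reasoning
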